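{- The generating function $D^+(x,y;t)$ of Dyck N-meanders is characterized by $$\begin{aligned}D^+(x,y;t)=1&+t\left(p_{ -1}x^{ -1}y^{ -1}+p_1xy+p_{ -1,1}x^{ -1}y\right)\big(D^+(x,y;t)-D^+(0,y;t)\big)\\&+t\left(p_{ -1}xy^{ -1}+(p_1+p_{ -1,1})xy\right)\big(D^+(0,y;t)-D^+(0,0;t)\big)\\&+t(p_1+p_{ -1,1})xy\,D^+(0,0;t).\end{aligned}$$
   Context: An N-step is a non-empty finite set of integers. Dyck N-walks are finite sequences $w=(s_1,\dots,s_n)$ of N-steps from $\{\{ -1\},\{1\},\{ -1,1\}\}$, starting at $0$, $|w|=n$, with N-step weights $p_{ -1},p_1,p_{ -1,1}$ and walk weight the product. A classical walk $(v_1,\dots,v_n)$ with positions $\omega_k=\sum_{i\le k}v_i$ is compatible with $w$ if $v_i\in s_i$ for all $i$; it is a meander if all $\omega_k\ge0$. An N-meander is an N-walk compatible with at least one meander; its reachable points are the endpoints of all compatible meanders, with minimum $\min^+(w)$ and maximum $\max^+(w)$. $D^+(x,y;t)=\sum_w(\prod_ip_{s_i})x^{\min^+(w)}y^{\max^+(w)}t^{|w|}$ over Dyck N-meanders. -}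

module Defs where

open import Data.Nat using (ℕ; zero; suc)
open import Data.Integer as ℤ using (ℤ; +_; -[1+_]; _⊓_; _⊔_; ∣_∣)
open import Data.List using (List; []; _∷_; map; concatMap; filter; foldr)
open import Data.List.Relation.Unary.All as All using (All)
open import Data.List.Relation.Unary.Any as Any using (Any)
open import Relation.Nullary using (yes; no)
open import Algebra.Bundles using (CommutativeRing)

data NStep : Set where
  s₋ s₊ s± : NStep

elems : NStep → List ℤ
elems s₋ = -[1+ 0 ] ∷ []
elems s₊ = + 1 ∷ []
elems s± = -[1+ 0 ] ∷ + 1 ∷ []

NWalk : Set
NWalk = List NStep

allNWalks : ℕ → List NWalk
allNWalks zero = [] ∷ []
allNWalks (suc n) = concatMap (λ s → map (s ∷_) (allNWalks n)) (s₋ ∷ s₊ ∷ s± ∷ [])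

compatible : NWalk → List (List ℤ)
compatible [] = [] ∷ []
compatible (s ∷ w) = concatMap (λ v → map (v ∷_) (compatible w)) (elems s)

positions : ℤ → List ℤ → List ℤ
positions acc [] = []
positions acc (v ∷ vs) = (acc ℤ.+ v) ∷ positions (acc ℤ.+ v) vs

endpoint : List ℤ → ℤ
endpoint = foldr ℤ._+_ (+ 0)

IsMeander : List ℤ → Set
IsMeander v = All (ℤ._≤_ (+ 0)) (positions (+ 0) v)

isMeander? : (v : List ℤ) → Relation.Nullary.Dec (IsMeander v)
isMeander? v = All.all? (λ z → + 0 ℤ.≤? z) (positions (+ 0) v)

IsNMeander : NWalk → Set
IsNMeander w = Any IsMeander (compatible w)

isNMeander? : (w : NWalk) → Relation.Nullary.Dec (IsNMeander w)
isNMeander? w = Any.any? isMeander? (compatible w)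

reachable : NWalk → List ℤ
reachable w = map endpoint (filter isMeander? (compatible w))

minL maxL : List ℤ → ℤ
minL [] = + 0
minL (a ∷ as) = foldr _⊓_ a as
maxL [] = + 0
maxL (a ∷ as) = foldr _⊔_ a as

min⁺ max⁺ : NWalk → ℤ
min⁺ w = minL (reachable w)
max⁺ w = maxL (reachable w)

module GF {c ℓ} (R : CommutativeRing c ℓ) where
  open CommutativeRing R

  pow : Carrier → ℕ → Carrier
  pow a zero = 1#
  pow a (suc n) = a * pow a n

  stepWeight : (p₋₁ p₁ p₋₁₁ : Carrier) → NStep → Carrier
  stepWeight p₋₁ p₁ p₋₁₁ s₋ = p₋₁
  stepWeight p₋₁ p₁ p₋₁₁ s₊ = p₁
  stepWeight p₋₁ p₁ p₋₁₁ s± = p₋₁₁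

  weight : (p₋₁ p₁ p₋₁₁ : Carrier) → NWalk → Carrier
  weight p₋₁ p₁ p₋₁₁ = foldr (λ s acc → stepWeight p₋₁ p₁ p₋₁₁ s * acc) 1#

  term : (p₋₁ p₁ p₋₁₁ x y : Carrier) → NWalk → Carrier
  term p₋₁ p₁ p₋₁₁ x y w with isNMeander? w
  ... | yes _ = weight p₋₁ p₁ p₋₁₁ w * pow x ∣ min⁺ w ∣ * pow y ∣ max⁺ w ∣
  ... | no _ = 0#

  -- [t^n] D⁺(x,y;t)
  Dcoeff : (p₋₁ p₁ p₋₁₁ x y : Carrier) → ℕ → Carrier
  Dcoeff p₋₁ p₁ p₋₁₁ x y n = foldr _+_ 0# (map (term p₋₁ p₁ p₋₁₁ x y) (allNWalks n))

-- The reachable points of a Dyck N-meander form an arithmetic progression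
-- m, m + 2, …, m + 2j (so min⁺ = m and max⁺ = m + 2j), and appending an N-step changes
-- (m, j) by a rule that only distinguishes m > 0, m = 0 < j and m = j = 0.  Summed over
-- the three N-steps, the terms p_s x^min⁺ y^max⁺ of the one-step extensions therefore
-- equal x^m y^(m+2j) times p₋₁x⁻¹y⁻¹ + p₁xy + p₋₁₁x⁻¹y, p₋₁xy⁻¹ + (p₁ + p₋₁₁)xy or
-- (p₁ + p₋₁₁)xy respectively.  Setting x = 0 keeps exactly the walks with m = 0, and
-- setting also y = 0 those with m = j = 0, so the three classes contribute
-- D⁺(x,y) − D⁺(0,y), D⁺(0,y) − D⁺(0,0) and D⁺(0,0).
module Submission where

open import Defs
open import Algebra.Bundles using (CommutativeRing)
open import Data.Empty using (⊥; ⊥-elim)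
open import Data.Integer as ℤ using (ℤ; +_; -[1+_]; +≤+; _⊓_; _⊔_)
import Data.Integer.Properties as ℤP
open import Data.List using (List; []; _∷_; _++_; _∷ʳ_; map; concatMap; foldr; foldl)
import Data.List.Properties as ListP
open import Data.List.Membership.Propositional using (_∈_; find; lose)
open import Data.List.Membership.Propositional.Properties
  using (∈-map⁺; ∈-map⁻; ∈-concatMap⁺; ∈-concatMap⁻; ∈-filter⁺; ∈-filter⁻)
open import Data.List.Relation.Unary.All as All using (All; []; _∷_)
open import Data.List.Relation.Unary.Any as Any using (Any; here; there)
open import Data.List.Reverse using (Reverse; []; _∶_∶ʳ_; reverseView)
open import Data.Nat as ℕ using (ℕ; zero; suc; _≤_; z≤n; s≤s)
import Data.Nat.Properties as ℕP
open import Data.Product using (∃-syntax; _×_; _,_)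
open import Data.Sum using ([_,_])
open import Function using (_∘_)
open import Relation.Binary.PropositionalEquality as ≡ using (_≡_; refl)
open import Relation.Nullary using (yes; no)

-- Meanders as paths in ℕ

data Step : NStep → ℕ → ℕ → Set where
  up₊   : ∀ {r} → Step s₊ r (suc r)
  up±   : ∀ {r} → Step s± r (suc r)
  down₋ : ∀ {r} → Step s₋ (suc r) r
  down± : ∀ {r} → Step s± (suc r) r

-- Heights live in ℕ, so a path is exactly a meander compatible with the N-walk.
data Path : ℕ → NWalk → ℕ → Set where
  []  : ∀ {a} → Path a [] a
  _∷_ : ∀ {a b n s w} → Step s a b → Path b w n → Path a (s ∷ w) n

MeanderFrom : ℤ → List ℤ → Set
MeanderFrom a v = All (+ 0 ℤ.≤_) (positions a v)

Step⇒∈elems : ∀ {s a b} → Step s a b → ∃[ e ] e ∈ elems s × + a ℤ.+ e ≡ + b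
Step⇒∈elems {a = a} up₊ = + 1 , here refl , ≡.cong +_ (ℕP.+-comm a 1)
Step⇒∈elems {a = a} up± = + 1 , there (here refl) , ≡.cong +_ (ℕP.+-comm a 1)
Step⇒∈elems down₋ = -[1+ 0 ] , here refl , refl
Step⇒∈elems down± = -[1+ 0 ] , here refl , refl

∈elems⇒Step : ∀ {s e} a → e ∈ elems s → + 0 ℤ.≤ + a ℤ.+ e → ∃[ b ] Step s a b × + a ℤ.+ e ≡ + b
∈elems⇒Step {s₋} zero    (here refl) ()
∈elems⇒Step {s₋} (suc a) (here refl) _ = a , down₋ , refl
∈elems⇒Step {s₊} a       (here refl) _ = suc a , up₊ , ≡.cong +_ (ℕP.+-comm a 1)
∈elems⇒Step {s±} zero    (here refl) ()
∈elems⇒Step {s±} (suc a) (here refl) _ = a , down± , refl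
∈elems⇒Step {s±} a       (there (here refl)) _ = suc a , up± , ≡.cong +_ (ℕP.+-comm a 1)

∈compatible-∷⁻ : ∀ s w {v} → v ∈ compatible (s ∷ w) →
                 ∃[ e ] ∃[ v′ ] e ∈ elems s × v′ ∈ compatible w × v ≡ e ∷ v′
∈compatible-∷⁻ s w v∈ with find (∈-concatMap⁻ (λ e → map (e ∷_) (compatible w)) {xs = elems s} v∈)
... | e , e∈ , v∈map with ∈-map⁻ (e ∷_) v∈map
... | v′ , v′∈ , refl = e , v′ , e∈ , v′∈ , refl

∈compatible-∷⁺ : ∀ s w {e v} → e ∈ elems s → v ∈ compatible w → e ∷ v ∈ compatible (s ∷ w)
∈compatible-∷⁺ s w {e} {v} e∈ v∈ =
  ∈-concatMap⁺ (λ e → map (e ∷_) (compatible w)) {xs = elems s}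
    (lose {P = λ e′ → e ∷ v ∈ map (e′ ∷_) (compatible w)} e∈ (∈-map⁺ (e ∷_) v∈))

endpoint-∷ : ∀ a e v {b n} → + a ℤ.+ e ≡ + b → + b ℤ.+ endpoint v ≡ + n →
             + a ℤ.+ endpoint (e ∷ v) ≡ + n
endpoint-∷ a e v a+e≡b b+v≡n =
  ≡.trans (≡.sym (ℤP.+-assoc (+ a) e (endpoint v))) (≡.trans (≡.cong (ℤ._+ endpoint v) a+e≡b) b+v≡n)

meander⇒Path : ∀ a w {v} → v ∈ compatible w → MeanderFrom (+ a) v →
               ∃[ n ] Path a w n × + a ℤ.+ endpoint v ≡ + n
meander⇒Path a [] (here refl) _ = a , [] , ≡.cong +_ (ℕP.+-identityʳ a)
meander⇒Path a (s ∷ w) v∈ mv with ∈compatible-∷⁻ s w v∈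
meander⇒Path a (s ∷ w) v∈ (0≤a+e ∷ mv′) | e , v′ , e∈ , v′∈ , refl with ∈elems⇒Step a e∈ 0≤a+e
... | b , st , a+e≡b with meander⇒Path b w v′∈ (≡.subst (λ h → MeanderFrom h v′) a+e≡b mv′)
... | n , path , b+v′≡n = n , st ∷ path , endpoint-∷ a e v′ a+e≡b b+v′≡n

Path⇒meander : ∀ {a w n} → Path a w n →
               ∃[ v ] v ∈ compatible w × MeanderFrom (+ a) v × + a ℤ.+ endpoint v ≡ + n
Path⇒meander {a} [] = [] , here refl , [] , ≡.cong +_ (ℕP.+-identityʳ a)
Path⇒meander {w = s ∷ w} (st ∷ path) with Step⇒∈elems st | Path⇒meander path
... | e , e∈ , a+e≡b | v , v∈ , mv , b+v≡n =
  e ∷ v , ∈compatible-∷⁺ s w e∈ v∈ ,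
  (≡.subst (+ 0 ℤ.≤_) (≡.sym a+e≡b) (+≤+ z≤n)
     ∷ ≡.subst (λ h → MeanderFrom h v) (≡.sym a+e≡b) mv) ,
  endpoint-∷ _ e v a+e≡b b+v≡n

∈reachable⇒Path : ∀ w {z} → z ∈ reachable w → ∃[ n ] Path 0 w n × z ≡ + n
∈reachable⇒Path w z∈ with ∈-map⁻ endpoint z∈
... | v , v∈filter , refl with ∈-filter⁻ isMeander? {xs = compatible w} v∈filter
... | v∈ , mv with meander⇒Path 0 w v∈ mv
... | n , path , 0+v≡n = n , path , ≡.trans (≡.sym (ℤP.+-identityˡ (endpoint v))) 0+v≡n

Path⇒∈reachable : ∀ {w n} → Path 0 w n → + n ∈ reachable w
Path⇒∈reachable {w} path with Path⇒meander path
... | v , v∈ , mv , 0+v≡n =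
  ≡.subst (_∈ reachable w) (≡.trans (≡.sym (ℤP.+-identityˡ (endpoint v))) 0+v≡n)
    (∈-map⁺ endpoint (∈-filter⁺ isMeander? v∈ mv))

IsNMeander⇒Path : ∀ w → IsNMeander w → ∃[ n ] Path 0 w n
IsNMeander⇒Path w nm with find nm
... | v , v∈ , mv with meander⇒Path 0 w v∈ mv
... | n , path , _ = n , path

Path⇒IsNMeander : ∀ {w n} → Path 0 w n → IsNMeander w
Path⇒IsNMeander path with Path⇒meander path
... | v , v∈ , mv , _ = lose v∈ mv

Path-∷ʳ⁻ : ∀ {a} w {s n} → Path a (w ∷ʳ s) n → ∃[ r ] Path a w r × Step s r n
Path-∷ʳ⁻ []      (st ∷ []) = _ , [] , st
Path-∷ʳ⁻ (_ ∷ w) (st ∷ path) with Path-∷ʳ⁻ w path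
... | r , path′ , st′ = r , st ∷ path′ , st′

Path-∷ʳ⁺ : ∀ {a w r s n} → Path a w r → Step s r n → Path a (w ∷ʳ s) n
Path-∷ʳ⁺ []           st = st ∷ []
Path-∷ʳ⁺ (st₀ ∷ path) st = st₀ ∷ Path-∷ʳ⁺ path st

-- The set of reachable points

twice : ℕ → ℕ
twice zero    = zero
twice (suc k) = suc (suc (twice k))

twice-mono-≤ : ∀ {k j} → k ≤ j → twice k ≤ twice j
twice-mono-≤ z≤n       = z≤n
twice-mono-≤ (s≤s k≤j) = s≤s (s≤s (twice-mono-≤ k≤j))

+-twice-suc : ∀ m k → m ℕ.+ twice (suc k) ≡ suc (suc (m ℕ.+ twice k))
+-twice-suc m k = ≡.trans (ℕP.+-suc m (suc (twice k))) (≡.cong suc (ℕP.+-suc m (twice k)))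

-- prog m j is the progression m, m + 2, …, m + 2j.
data Shape : Set where
  ∅    : Shape
  prog : ℕ → ℕ → Shape

infix 4 _∈ₛ_

_∈ₛ_ : ℕ → Shape → Set
n ∈ₛ ∅        = ⊥
n ∈ₛ prog m j = ∃[ k ] k ≤ j × n ≡ m ℕ.+ twice k

min∈prog : ∀ m j → m ∈ₛ prog m j
min∈prog m j = 0 , z≤n , ≡.sym (ℕP.+-identityʳ m)

max∈prog : ∀ m j → m ℕ.+ twice j ∈ₛ prog m j
max∈prog m j = j , ℕP.≤-refl , refl

extend : Shape → NStep → Shape
extend ∅                   _  = ∅
extend (prog m j)          s₊ = prog (suc m) j
extend (prog (suc m) j)    s₋ = prog m j
extend (prog zero (suc j)) s₋ = prog 1 j
extend (prog zero zero)    s₋ = ∅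
extend (prog (suc m) j)    s± = prog m (suc j)
extend (prog zero j)       s± = prog 1 j

extend-sound : ∀ σ {s r n} → Step s r n → r ∈ₛ σ → n ∈ₛ extend σ s
extend-sound (prog m j)          up₊   (k , k≤j , refl) = k , k≤j , refl
extend-sound (prog (suc m) j)    down₋ (k , k≤j , refl) = k , k≤j , refl
extend-sound (prog zero (suc j)) down₋ (suc k , s≤s k≤j , refl) = k , k≤j , refl
extend-sound (prog zero j)       down₋ (zero , _ , ())
extend-sound (prog (suc m) j)    down± (k , k≤j , refl) = k , ℕP.m≤n⇒m≤1+n k≤j , refl
extend-sound (prog zero j)       down± (suc k , k<j , refl) = k , ℕP.<⇒≤ k<j , refl
extend-sound (prog zero j)       down± (zero , _ , ())
extend-sound (prog (suc m) j)    up±   (k , k≤j , refl) = suc k , s≤s k≤j , ≡.sym (+-twice-suc m k)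
extend-sound (prog zero j)       up±   (k , k≤j , refl) = k , k≤j , refl

extend-complete : ∀ σ s {n} → n ∈ₛ extend σ s → ∃[ r ] r ∈ₛ σ × Step s r n
extend-complete (prog m j)          s₊ (k , k≤j , refl) = _ , (k , k≤j , refl) , up₊
extend-complete (prog (suc m) j)    s₋ (k , k≤j , refl) = _ , (k , k≤j , refl) , down₋
extend-complete (prog zero (suc j)) s₋ (k , k≤j , refl) = _ , (suc k , s≤s k≤j , refl) , down₋
extend-complete (prog (suc m) j)    s± (zero , _ , refl) = _ , (zero , z≤n , refl) , down±
extend-complete (prog (suc m) j)    s± (suc k , s≤s k≤j , refl) =
  _ , (k , k≤j , refl) , ≡.subst (Step s± _) (≡.sym (+-twice-suc m k)) up±
extend-complete (prog zero j)       s± (k , k≤j , refl) = _ , (k , k≤j , refl) , up±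

shape : NWalk → Shape
shape = foldl extend (prog 0 0)

shape-∷ʳ : ∀ w s → shape (w ∷ʳ s) ≡ extend (shape w) s
shape-∷ʳ w s = ListP.foldl-++ extend (prog 0 0) w (s ∷ [])

Path⇒∈shape : ∀ {w n} → Path 0 w n → n ∈ₛ shape w
Path⇒∈shape {w} = go (reverseView w)
  where
  go : ∀ {w n} → Reverse w → Path 0 w n → n ∈ₛ shape w
  go [] [] = min∈prog 0 0
  go (w ∶ rw ∶ʳ s) path with Path-∷ʳ⁻ w path
  ... | r , path′ , st =
    ≡.subst (_ ∈ₛ_) (≡.sym (shape-∷ʳ w s)) (extend-sound (shape w) st (go rw path′))

∈shape⇒Path : ∀ w {n} → n ∈ₛ shape w → Path 0 w n
∈shape⇒Path w = go (reverseView w)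
  where
  go : ∀ {w n} → Reverse w → n ∈ₛ shape w → Path 0 w n
  go [] (zero , z≤n , refl) = []
  go (w ∶ rw ∶ʳ s) n∈ with extend-complete (shape w) s (≡.subst (_ ∈ₛ_) (shape-∷ʳ w s) n∈)
  ... | r , r∈ , st = Path-∷ʳ⁺ (go rw r∈) st

∈reachable⇒∈shape : ∀ w {z} → z ∈ reachable w → ∃[ n ] n ∈ₛ shape w × z ≡ + n
∈reachable⇒∈shape w z∈ with ∈reachable⇒Path w z∈
... | n , path , z≡n = n , Path⇒∈shape path , z≡n

∈shape⇒∈reachable : ∀ w {n} → n ∈ₛ shape w → + n ∈ reachable w
∈shape⇒∈reachable w = Path⇒∈reachable ∘ ∈shape⇒Path w

minL-unique : ∀ {m L} → m ∈ L → All (m ℤ.≤_) L → minL L ≡ m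
minL-unique {m} {a ∷ as} m∈ (m≤a ∷ m≤as) = ℤP.≤-antisym upper lower
  where
  lower : m ℤ.≤ foldr _⊓_ a as
  lower = ListP.foldr-preservesᵇ ℤP.⊓-glb m≤a m≤as
  upper : foldr _⊓_ a as ℤ.≤ m
  upper = ListP.foldr-preservesᵒ {P = ℤ._≤ m}
            (λ u v → [ ℤP.i≤j⇒i⊓k≤j v , ℤP.i≤j⇒k⊓i≤j u ]) a as
            (Any.toSum (Any.map (ℤP.≤-reflexive ∘ ≡.sym) m∈))

maxL-unique : ∀ {m L} → m ∈ L → All (ℤ._≤ m) L → maxL L ≡ m
maxL-unique {m} {a ∷ as} m∈ (a≤m ∷ as≤m) = ℤP.≤-antisym upper lower
  where
  upper : foldr _⊔_ a as ℤ.≤ m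
  upper = ListP.foldr-preservesᵇ ℤP.⊔-lub a≤m as≤m
  lower : m ℤ.≤ foldr _⊔_ a as
  lower = ListP.foldr-preservesᵒ {P = m ℤ.≤_}
            (λ u v → [ ℤP.i≤j⇒i≤j⊔k v , ℤP.i≤j⇒i≤k⊔j u ]) a as
            (Any.toSum (Any.map ℤP.≤-reflexive m∈))

min⁺-prog : ∀ w {m j} → shape w ≡ prog m j → min⁺ w ≡ + m
min⁺-prog w {m} {j} eq =
  minL-unique (∈shape⇒∈reachable w (≡.subst (m ∈ₛ_) (≡.sym eq) (min∈prog m j)))
              (All.tabulate lower-bound)
  where
  lower-bound : ∀ {z} → z ∈ reachable w → + m ℤ.≤ z
  lower-bound z∈ with ∈reachable⇒∈shape w z∈
  ... | n , n∈ , refl with ≡.subst (n ∈ₛ_) eq n∈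
  ... | k , _ , refl = +≤+ (ℕP.m≤m+n m (twice k))

max⁺-prog : ∀ w {m j} → shape w ≡ prog m j → max⁺ w ≡ + (m ℕ.+ twice j)
max⁺-prog w {m} {j} eq =
  maxL-unique (∈shape⇒∈reachable w (≡.subst (_ ∈ₛ_) (≡.sym eq) (max∈prog m j)))
              (All.tabulate upper-bound)
  where
  upper-bound : ∀ {z} → z ∈ reachable w → z ℤ.≤ + (m ℕ.+ twice j)
  upper-bound z∈ with ∈reachable⇒∈shape w z∈
  ... | n , n∈ , refl with ≡.subst (n ∈ₛ_) eq n∈
  ... | k , k≤j , refl = +≤+ (ℕP.+-monoʳ-≤ m (twice-mono-≤ k≤j))

module PolynomialIdentities {c ℓ} (R : CommutativeRing c ℓ) where
  open CommutativeRing R renaming (refl to ≈-refl)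
  open import Algebra.Solver.Ring.NaturalCoefficients.Default commutativeSemiring
    using (solve; _:=_; _:+_; _:*_; con)

  A-shift-poly : ∀ p₋₁ p₁ p₋₁₁ x y x⁻¹ y⁻¹ V X Y →
    (p₋₁ * x⁻¹ * y⁻¹ + p₁ * x * y + p₋₁₁ * x⁻¹ * y) * (V * ((x * X) * (y * Y))) ≈
    (x * x⁻¹) * ((y * y⁻¹) * (V * p₋₁ * (X * Y)))
      + (V * p₁ * ((x * (x * X)) * (y * (y * Y))) + (x * x⁻¹) * (V * p₋₁₁ * (X * (y * (y * Y)))))
  A-shift-poly = solve 10 (λ p₋₁ p₁ p₋₁₁ x y x⁻¹ y⁻¹ V X Y →
    (p₋₁ :* x⁻¹ :* y⁻¹ :+ p₁ :* x :* y :+ p₋₁₁ :* x⁻¹ :* y) :* (V :* ((x :* X) :* (y :* Y))) :=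
    (x :* x⁻¹) :* ((y :* y⁻¹) :* (V :* p₋₁ :* (X :* Y)))
      :+ (V :* p₁ :* ((x :* (x :* X)) :* (y :* (y :* Y)))
          :+ (x :* x⁻¹) :* (V :* p₋₁₁ :* (X :* (y :* (y :* Y)))))) ≈-refl

  B-shift-poly : ∀ p₋₁ p₁ p₋₁₁ x y y⁻¹ V Y →
    (p₋₁ * x * y⁻¹ + (p₁ + p₋₁₁) * x * y) * (V * (1# * (y * (y * Y)))) ≈
    (y * y⁻¹) * (V * p₋₁ * ((x * 1#) * (y * Y)))
      + (V * p₁ * ((x * 1#) * (y * (y * (y * Y)))) + V * p₋₁₁ * ((x * 1#) * (y * (y * (y * Y)))))
  B-shift-poly = solve 8 (λ p₋₁ p₁ p₋₁₁ x y y⁻¹ V Y →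
    (p₋₁ :* x :* y⁻¹ :+ (p₁ :+ p₋₁₁) :* x :* y) :* (V :* (con 1 :* (y :* (y :* Y)))) :=
    (y :* y⁻¹) :* (V :* p₋₁ :* ((x :* con 1) :* (y :* Y)))
      :+ (V :* p₁ :* ((x :* con 1) :* (y :* (y :* (y :* Y))))
          :+ V :* p₋₁₁ :* ((x :* con 1) :* (y :* (y :* (y :* Y)))))) ≈-refl

  C-shift : ∀ p₋₁ p₁ p₋₁₁ x y V →
    (p₁ + p₋₁₁) * x * y * (V * (1# * 1#)) ≈
    V * p₋₁ * 0# + (V * p₁ * ((x * 1#) * (y * 1#)) + V * p₋₁₁ * ((x * 1#) * (y * 1#)))
  C-shift = solve 6 (λ p₋₁ p₁ p₋₁₁ x y V →
    (p₁ :+ p₋₁₁) :* x :* y :* (V :* (con 1 :* con 1)) :=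
    V :* p₋₁ :* con 0 :+ (V :* p₁ :* ((x :* con 1) :* (y :* con 1))
                          :+ V :* p₋₁₁ :* ((x :* con 1) :* (y :* con 1)))) ≈-refl

module Series {c ℓ} (R : CommutativeRing c ℓ) where
  open CommutativeRing R renaming (refl to ≈-refl) hiding (zero)
  open GF R
  open import Algebra.Properties.Ring ring using (-0#≈0#; -‿+-comm)
  open import Algebra.Properties.Group +-group using (x≈y⇒x∙y⁻¹≈ε)
  open import Algebra.Properties.CommutativeSemigroup +-commutativeSemigroup using (interchange)
  open import Relation.Binary.Reasoning.Setoid setoid
  open PolynomialIdentities R

  ∑ : {X : Set} → List X → (X → Carrier) → Carrier
  ∑ xs f = foldr _+_ 0# (map f xs)

  ∑-cong : {X : Set} (xs : List X) {f g : X → Carrier} → (∀ u → f u ≈ g u) → ∑ xs f ≈ ∑ xs g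
  ∑-cong []       _   = ≈-refl
  ∑-cong (u ∷ xs) f≈g = +-cong (f≈g u) (∑-cong xs f≈g)

  ∑-0# : {X : Set} (xs : List X) → ∑ xs (λ _ → 0#) ≈ 0#
  ∑-0# []       = ≈-refl
  ∑-0# (_ ∷ xs) = trans (+-identityˡ _) (∑-0# xs)

  ∑-++ : {X : Set} (xs ys : List X) (f : X → Carrier) → ∑ (xs ++ ys) f ≈ ∑ xs f + ∑ ys f
  ∑-++ []       ys f = sym (+-identityˡ _)
  ∑-++ (u ∷ xs) ys f = trans (+-congˡ (∑-++ xs ys f)) (sym (+-assoc (f u) _ _))

  ∑-map : {X Y : Set} (g : X → Y) (xs : List X) (f : Y → Carrier) → ∑ (map g xs) f ≡ ∑ xs (f ∘ g)
  ∑-map g xs f = ≡.cong (foldr _+_ 0#) (≡.sym (ListP.map-∘ xs))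

  ∑-concatMap : {X Y : Set} (g : X → List Y) (xs : List X) (f : Y → Carrier) →
                ∑ (concatMap g xs) f ≈ ∑ xs (λ u → ∑ (g u) f)
  ∑-concatMap g []       f = ≈-refl
  ∑-concatMap g (u ∷ xs) f = trans (∑-++ (g u) _ f) (+-congˡ (∑-concatMap g xs f))

  ∑-+ : {X : Set} (xs : List X) (f g : X → Carrier) → ∑ xs (λ u → f u + g u) ≈ ∑ xs f + ∑ xs g
  ∑-+ []       f g = sym (+-identityʳ 0#)
  ∑-+ (u ∷ xs) f g = trans (+-congˡ (∑-+ xs f g)) (interchange (f u) (g u) _ _)

  ∑-*ˡ : {X : Set} (xs : List X) (k : Carrier) (f : X → Carrier) → ∑ xs (λ u → k * f u) ≈ k * ∑ xs f
  ∑-*ˡ []       k f = sym (zeroʳ k)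
  ∑-*ˡ (u ∷ xs) k f = trans (+-congˡ (∑-*ˡ xs k f)) (sym (distribˡ k (f u) _))

  ∑-neg : {X : Set} (xs : List X) (f : X → Carrier) → ∑ xs (λ u → - f u) ≈ - ∑ xs f
  ∑-neg []       f = sym -0#≈0#
  ∑-neg (u ∷ xs) f = trans (+-congˡ (∑-neg xs f)) (-‿+-comm (f u) _)

  ∑-- : {X : Set} (xs : List X) (f g : X → Carrier) → ∑ xs (λ u → f u - g u) ≈ ∑ xs f - ∑ xs g
  ∑-- xs f g = trans (∑-+ xs f (λ u → - g u)) (+-congˡ (∑-neg xs g))

  steps : List NStep
  steps = s₋ ∷ s₊ ∷ s± ∷ []

  ∑-steps : (f : NStep → Carrier) → ∑ steps f ≈ f s₋ + (f s₊ + f s±)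
  ∑-steps f = +-congˡ (+-congˡ (+-identityʳ (f s±)))

  ∑-allNWalks-∷ : ∀ n (f : NWalk → Carrier) →
                  ∑ (allNWalks (suc n)) f ≈ ∑ steps (λ s → ∑ (allNWalks n) (λ w → f (s ∷ w)))
  ∑-allNWalks-∷ n f =
    trans (∑-concatMap (λ s → map (s ∷_) (allNWalks n)) steps f)
          (∑-cong steps (λ s → reflexive (∑-map (s ∷_) (allNWalks n) f)))

  ∑-allNWalks-∷ʳ : ∀ n (f : NWalk → Carrier) →
                   ∑ (allNWalks (suc n)) f ≈ ∑ (allNWalks n) (λ w → ∑ steps (λ s → f (w ∷ʳ s)))
  ∑-allNWalks-∷ʳ zero f = begin
    ∑ (allNWalks 1) f                      ≈⟨ ∑-allNWalks-∷ 0 f ⟩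
    ∑ steps (λ s → f (s ∷ []) + 0#)        ≈⟨ ∑-cong steps (λ s → +-identityʳ (f (s ∷ []))) ⟩
    ∑ steps (λ s → f (s ∷ []))             ≈⟨ +-identityʳ _ ⟨
    ∑ ([] ∷ []) (λ w → ∑ steps (λ s → f (w ∷ʳ s))) ∎
  ∑-allNWalks-∷ʳ (suc n) f = begin
    ∑ (allNWalks (suc (suc n))) f
      ≈⟨ ∑-allNWalks-∷ (suc n) f ⟩
    ∑ steps (λ s → ∑ (allNWalks (suc n)) (λ w → f (s ∷ w)))
      ≈⟨ ∑-cong steps (λ s → ∑-allNWalks-∷ʳ n (λ w → f (s ∷ w))) ⟩
    ∑ steps (λ s → ∑ (allNWalks n) (λ w → ∑ steps (λ t → f (s ∷ w ∷ʳ t))))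
      ≈⟨ ∑-allNWalks-∷ n (λ w → ∑ steps (λ t → f (w ∷ʳ t))) ⟨
    ∑ (allNWalks (suc n)) (λ w → ∑ steps (λ t → f (w ∷ʳ t)))
      ∎

  y≈0⇒x-y≈x : ∀ {x y} → y ≈ 0# → x - y ≈ x
  y≈0⇒x-y≈x {x} y≈0 = trans (+-congˡ (trans (-‿cong y≈0) -0#≈0#)) (+-identityʳ x)

  u≈1⇒u*x≈x : ∀ {u} x → u ≈ 1# → u * x ≈ x
  u≈1⇒u*x≈x x u≈1 = trans (*-congʳ u≈1) (*-identityˡ x)

  monomial : Carrier → Carrier → Shape → Carrier
  monomial a b ∅          = 0#
  monomial a b (prog m j) = pow a m * pow b (m ℕ.+ twice j)

  monomial-0#-pos : ∀ b m j → monomial 0# b (prog (suc m) j) ≈ 0#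
  monomial-0#-pos b m j = trans (*-congʳ (zeroˡ _)) (zeroˡ _)

  module Weighted (p₋₁ p₁ p₋₁₁ : Carrier) where

    W : NWalk → Carrier
    W = weight p₋₁ p₁ p₋₁₁

    T : Carrier → Carrier → NWalk → Carrier
    T = term p₋₁ p₁ p₋₁₁

    weight-∷ʳ : ∀ w s → W (w ∷ʳ s) ≈ W w * stepWeight p₋₁ p₁ p₋₁₁ s
    weight-∷ʳ []      s = trans (*-identityʳ _) (sym (*-identityˡ _))
    weight-∷ʳ (t ∷ w) s = trans (*-congˡ (weight-∷ʳ w s)) (sym (*-assoc _ _ _))

    term-shape : ∀ a b w → T a b w ≈ W w * monomial a b (shape w)
    term-shape a b w with isNMeander? w | shape w in eq
    ... | yes _ | prog m j =
      trans (reflexive (≡.cong₂ (λ p q → W w * pow a ℤ.∣ p ∣ * pow b ℤ.∣ q ∣)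
                                (min⁺-prog w eq) (max⁺-prog w eq)))
            (*-assoc _ _ _)
    ... | no ¬nm | prog m j =
      ⊥-elim (¬nm (Path⇒IsNMeander (∈shape⇒Path w (≡.subst (m ∈ₛ_) (≡.sym eq) (min∈prog m j)))))
    ... | no _ | ∅ = sym (zeroʳ _)
    ... | yes nm | ∅ with IsNMeander⇒Path w nm
    ...   | n , path = ⊥-elim (≡.subst (n ∈ₛ_) eq (Path⇒∈shape path))

    term-∷ʳ : ∀ a b w s →
              T a b (w ∷ʳ s) ≈ W w * stepWeight p₋₁ p₁ p₋₁₁ s * monomial a b (extend (shape w) s)
    term-∷ʳ a b w s =
      trans (term-shape a b (w ∷ʳ s))
            (*-cong (weight-∷ʳ w s) (reflexive (≡.cong (monomial a b) (shape-∷ʳ w s))))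

    module Recurrence (x y x⁻¹ y⁻¹ : Carrier) (x*x⁻¹≈1 : x * x⁻¹ ≈ 1#) (y*y⁻¹≈1 : y * y⁻¹ ≈ 1#) where

      A B C : Carrier
      A = p₋₁ * x⁻¹ * y⁻¹ + p₁ * x * y + p₋₁₁ * x⁻¹ * y
      B = p₋₁ * x * y⁻¹ + (p₁ + p₋₁₁) * x * y
      C = (p₁ + p₋₁₁) * x * y

      next : Carrier → Carrier → Carrier → Carrier
      next a b c = A * (a - b) + B * (b - c) + C * c

      next-cong : ∀ {a a′ b b′ c c′} → a ≈ a′ → b ≈ b′ → c ≈ c′ → next a b c ≈ next a′ b′ c′
      next-cong a≈a′ b≈b′ c≈c′ =
        +-cong (+-cong (*-congˡ (+-cong a≈a′ (-‿cong b≈b′))) (*-congˡ (+-cong b≈b′ (-‿cong c≈c′))))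
               (*-congˡ c≈c′)

      next-A : ∀ {a b c} → b ≈ 0# → c ≈ 0# → next a b c ≈ A * a
      next-A {a} b≈0 c≈0 = begin
        A * (a - _) + B * (_ - _) + C * _
          ≈⟨ +-cong (+-cong (*-congˡ (y≈0⇒x-y≈x b≈0)) (*-congˡ (x≈y⇒x∙y⁻¹≈ε (trans b≈0 (sym c≈0)))))
                    (*-congˡ c≈0) ⟩
        A * a + B * 0# + C * 0#
          ≈⟨ +-cong (+-congˡ (zeroʳ B)) (zeroʳ C) ⟩
        A * a + 0# + 0#
          ≈⟨ trans (+-identityʳ _) (+-identityʳ _) ⟩
        A * a
          ∎

      next-B : ∀ {a b c} → a ≈ b → c ≈ 0# → next a b c ≈ B * b
      next-B {b = b} a≈b c≈0 = begin
        A * (_ - b) + B * (b - _) + C * _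
          ≈⟨ +-cong (+-cong (*-congˡ (x≈y⇒x∙y⁻¹≈ε a≈b)) (*-congˡ (y≈0⇒x-y≈x c≈0))) (*-congˡ c≈0) ⟩
        A * 0# + B * b + C * 0#
          ≈⟨ +-cong (+-congʳ (zeroʳ A)) (zeroʳ C) ⟩
        0# + B * b + 0#
          ≈⟨ trans (+-identityʳ _) (+-identityˡ _) ⟩
        B * b
          ∎

      next-C : ∀ {a b c} → a ≈ c → b ≈ c → next a b c ≈ C * c
      next-C {c = c} a≈c b≈c = begin
        A * (_ - _) + B * (_ - c) + C * c
          ≈⟨ +-congʳ (+-cong (*-congˡ (x≈y⇒x∙y⁻¹≈ε (trans a≈c (sym b≈c)))) (*-congˡ (x≈y⇒x∙y⁻¹≈ε b≈c))) ⟩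
        A * 0# + B * 0# + C * c
          ≈⟨ +-congʳ (+-cong (zeroʳ A) (zeroʳ B)) ⟩
        0# + 0# + C * c
          ≈⟨ trans (+-congʳ (+-identityʳ 0#)) (+-identityˡ _) ⟩
        C * c
          ∎

      ∑-next : {X : Set} (xs : List X) (f g h : X → Carrier) →
               ∑ xs (λ u → next (f u) (g u) (h u)) ≈ next (∑ xs f) (∑ xs g) (∑ xs h)
      ∑-next xs f g h = begin
        ∑ xs (λ u → A * (f u - g u) + B * (g u - h u) + C * h u)
          ≈⟨ trans (∑-+ xs _ _) (+-congʳ (∑-+ xs _ _)) ⟩
        ∑ xs (λ u → A * (f u - g u)) + ∑ xs (λ u → B * (g u - h u)) + ∑ xs (λ u → C * h u)
          ≈⟨ +-cong (+-cong (∑-*ˡ xs A _) (∑-*ˡ xs B _)) (∑-*ˡ xs C h) ⟩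
        A * ∑ xs (λ u → f u - g u) + B * ∑ xs (λ u → g u - h u) + C * ∑ xs h
          ≈⟨ +-congʳ (+-cong (*-congˡ (∑-- xs f g)) (*-congˡ (∑-- xs g h))) ⟩
        next (∑ xs f) (∑ xs g) (∑ xs h)
          ∎

      A-shift : ∀ V X Y →
        A * (V * ((x * X) * (y * Y))) ≈
        V * p₋₁ * (X * Y) + (V * p₁ * ((x * (x * X)) * (y * (y * Y))) + V * p₋₁₁ * (X * (y * (y * Y))))
      A-shift V X Y =
        trans (A-shift-poly p₋₁ p₁ p₋₁₁ x y x⁻¹ y⁻¹ V X Y)
              (+-cong (trans (u≈1⇒u*x≈x _ x*x⁻¹≈1) (u≈1⇒u*x≈x _ y*y⁻¹≈1))
                      (+-congˡ (u≈1⇒u*x≈x _ x*x⁻¹≈1)))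

      B-shift : ∀ V Y →
        B * (V * (1# * (y * (y * Y)))) ≈
        V * p₋₁ * ((x * 1#) * (y * Y))
          + (V * p₁ * ((x * 1#) * (y * (y * (y * Y)))) + V * p₋₁₁ * ((x * 1#) * (y * (y * (y * Y)))))
      B-shift V Y = trans (B-shift-poly p₋₁ p₁ p₋₁₁ x y y⁻¹ V Y) (+-congʳ (u≈1⇒u*x≈x _ y*y⁻¹≈1))

      successor : Carrier → Shape → NStep → Carrier
      successor V σ s = V * stepWeight p₋₁ p₁ p₋₁₁ s * monomial x y (extend σ s)

      ∑-extend : ∀ V σ →
        ∑ steps (successor V σ) ≈
        next (V * monomial x y σ) (V * monomial 0# y σ) (V * monomial 0# 0# σ)
      ∑-extend V ∅ = begin
        ∑ steps (successor V ∅)    ≈⟨ ∑-cong steps (λ s → zeroʳ (V * stepWeight p₋₁ p₁ p₋₁₁ s)) ⟩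
        ∑ steps (λ _ → 0#)         ≈⟨ ∑-0# steps ⟩
        0#                         ≈⟨ trans (*-congˡ (zeroʳ V)) (zeroʳ A) ⟨
        A * (V * 0#)               ≈⟨ next-A (zeroʳ V) (zeroʳ V) ⟨
        next (V * 0#) (V * 0#) (V * 0#) ∎
      ∑-extend V (prog (suc m) j) =
        trans (∑-steps (successor V (prog (suc m) j)))
          (trans (+-congˡ (+-congˡ (*-congˡ (*-congˡ (reflexive (≡.cong (pow y) (+-twice-suc m j)))))))
            (sym (trans (next-A (V*≈0 (monomial-0#-pos y m j)) (V*≈0 (monomial-0#-pos 0# m j)))
                        (A-shift V _ _))))
        where
        V*≈0 : ∀ {a} → a ≈ 0# → V * a ≈ 0#
        V*≈0 a≈0 = trans (*-congˡ a≈0) (zeroʳ V)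
      ∑-extend V (prog zero (suc j)) =
        trans (∑-steps (successor V (prog zero (suc j))))
          (sym (trans (next-B ≈-refl (trans (*-congˡ (trans (*-identityˡ _) (zeroˡ _))) (zeroʳ V)))
                      (B-shift V _)))
      ∑-extend V (prog zero zero) =
        trans (∑-steps (successor V (prog zero zero)))
              (sym (trans (next-C ≈-refl ≈-refl) (C-shift p₋₁ p₁ p₋₁₁ x y V)))

      ∑-successors : ∀ w → ∑ steps (λ s → T x y (w ∷ʳ s)) ≈ next (T x y w) (T 0# y w) (T 0# 0# w)
      ∑-successors w = begin
        ∑ steps (λ s → T x y (w ∷ʳ s))
          ≈⟨ ∑-cong steps (term-∷ʳ x y w) ⟩
        ∑ steps (successor (W w) (shape w))
          ≈⟨ ∑-extend (W w) (shape w) ⟩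
        next (W w * monomial x y (shape w)) (W w * monomial 0# y (shape w)) (W w * monomial 0# 0# (shape w))
          ≈⟨ next-cong (term-shape x y w) (term-shape 0# y w) (term-shape 0# 0# w) ⟨
        next (T x y w) (T 0# y w) (T 0# 0# w)
          ∎

      D : Carrier → Carrier → ℕ → Carrier
      D a b = Dcoeff p₋₁ p₁ p₋₁₁ a b

      D-zero : D x y 0 ≈ 1#
      D-zero = trans (+-identityʳ _) (trans (term-shape x y []) (trans (*-identityˡ _) (*-identityˡ _)))

      D-suc : ∀ n → D x y (suc n) ≈ next (D x y n) (D 0# y n) (D 0# 0# n)
      D-suc n = begin
        ∑ (allNWalks (suc n)) (T x y)
          ≈⟨ ∑-allNWalks-∷ʳ n (T x y) ⟩
        ∑ (allNWalks n) (λ w → ∑ steps (λ s → T x y (w ∷ʳ s)))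
          ≈⟨ ∑-cong (allNWalks n) ∑-successors ⟩
        ∑ (allNWalks n) (λ w → next (T x y w) (T 0# y w) (T 0# 0# w))
          ≈⟨ ∑-next (allNWalks n) (T x y) (T 0# y) (T 0# 0#) ⟩
        next (D x y n) (D 0# y n) (D 0# 0# n)
          ∎

proposition2p5 : ∀ {c ℓ} (R : CommutativeRing c ℓ) →
    let open CommutativeRing R
        open GF R
    in (p₋₁ p₁ p₋₁₁ x y x⁻¹ y⁻¹ : Carrier) → x * x⁻¹ ≈ 1# → y * y⁻¹ ≈ 1# →
      let D : Carrier → Carrier → ℕ → Carrier
          D a b n = Dcoeff p₋₁ p₁ p₋₁₁ a b n
      in (D x y 0 ≈ 1#)
         × (∀ n → D x y (suc n) ≈
              ((p₋₁ * x⁻¹ * y⁻¹ + p₁ * x * y + p₋₁₁ * x⁻¹ * y) * (D x y n - D 0# y n)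
               + (p₋₁ * x * y⁻¹ + (p₁ + p₋₁₁) * x * y) * (D 0# y n - D 0# 0# n)
               + (p₁ + p₋₁₁) * x * y * D 0# 0# n))
proposition2p5 R p₋₁ p₁ p₋₁₁ x y x⁻¹ y⁻¹ x*x⁻¹≈1 y*y⁻¹≈1 = D-zero , D-suc
  where open Series.Weighted.Recurrence R p₋₁ p₁ p₋₁₁ x y x⁻¹ y⁻¹ x*x⁻¹≈1 y*y⁻¹≈1
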